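{- For every $n\ge 5$, the rank generating functions $R_n(x)$ of the filter lattices $\mathcal{F}(\phi_n)$ satisfy \[ R_n(x)=\begin{cases} xR_{n-1}(x)+R_{n-2}(x), & \text{if } n \text{ is odd},\\ R_{n-1}(x)+x^2R_{n-2}(x), & \text{if } n \text{ is even}.\end{cases} \]
   Context: For $n\ge 0$, the $S$-fence $\phi_n$ is the poset on $\{x_1,\dots,x_n\}$ whose order is generated by the cover relations $x_2<x_1$, $x_3<x_2$, $x_2<x_4$, $x_5<x_4$, and, for every $i\ge 3$, $x_{2i-1}<x_{2i}$ and $x_{2i+1}<x_{2i}$, keeping only those relations whose elements both have index $\le n$ (so for small $n$, $\phi_n$ is the induced subposet on $\{x_1,\dots,x_n\}$; $\phi_0$ is empty). A filter of a poset is an up-set. $\mathcal{F}(\phi_n)$ is the set of all filters of $\phi_n$ ordered by reverse inclusion ($Y'\le Y$ iff $Y'\supseteq Y$); it is a finite distributive lattice whose bottom is $\phi_n$ and top is $\emptyset$, and the rank of a filter $Y$ is $n-|Y|$. Let $r_{n,k}$ be the number of elements of rank $k$ in $\mathcal{F}(\phi_n)$ (i.e. the number of filters of $\phi_n$ with exactly $n-k$ elements), and $R_n(x)=\sum_{k\ge0} r_{n,k}x^k$. -}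

module Defs where

open import Data.Nat using (ℕ; zero; suc; _+_; _*_; _∸_; _≟_)
open import Data.Nat.Properties using (+-suc)
open import Data.Bool using (Bool; true; false; T)
open import Data.Unit using (tt)
open import Data.Fin using (Fin; toℕ)
open import Data.Fin.Subset using (Subset; _∈_; ∣_∣; inside; outside)
open import Data.Fin.Subset.Properties using (_∈?_)
open import Data.Fin.Properties using (all?)
open import Data.List using (List; []; _∷_; map; _++_; filter; length)
open import Data.Vec using (_∷_; [])
open import Data.Product using (_×_; _,_)
open import Relation.Nullary using (Dec; yes; no; ¬_)
open import Relation.Nullary.Decidable using (_×-dec_; _→-dec_; map′)
open import Relation.Binary.PropositionalEquality using (_≡_; refl; subst)
open import Relation.Binary.Construct.Closure.ReflexiveTransitive using (Star; ε; _◅_)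

-- The S-fence φ_n.  Elements x_1,…,x_n are represented by Fin n, where
-- i : Fin n stands for x_{toℕ i + 1}.
--
-- Cover relations on indices (1-based):  a ⋖ b  means  x_a < x_b.
--   x2 < x1, x3 < x2, x2 < x4, x5 < x4, and for every i ≥ 3 (i = 3 + j):
--   x_{2i-1} < x_{2i}  and  x_{2i+1} < x_{2i}.

infix 4 _⋖_
data _⋖_ : ℕ → ℕ → Set where
  c21 : 2 ⋖ 1
  c32 : 3 ⋖ 2
  c24 : 2 ⋖ 4
  c54 : 5 ⋖ 4
  cL  : ∀ j → 5 + 2 * j ⋖ 6 + 2 * j
  cR  : ∀ j → 7 + 2 * j ⋖ 6 + 2 * j

Cover : (n : ℕ) → Fin n → Fin n → Set
Cover n a b = suc (toℕ a) ⋖ suc (toℕ b)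

_≤φ_ : {n : ℕ} → Fin n → Fin n → Set
_≤φ_ {n} = Star (Cover n)

IsFilter : {n : ℕ} → Subset n → Set
IsFilter {n} Y = ∀ {a b : Fin n} → a ≤φ b → a ∈ Y → b ∈ Y

-- covHi x y = cov (5 + x) (6 + y)
covHi : ℕ → ℕ → Bool
covHi (suc (suc x)) (suc (suc y)) = covHi x y
covHi 0 0 = true
covHi 2 0 = true
covHi _ _ = false

cov : ℕ → ℕ → Bool
cov (suc (suc (suc (suc (suc a))))) (suc (suc (suc (suc (suc (suc b)))))) = covHi a b
cov 2 1 = true
cov 3 2 = true
cov 2 4 = true
cov 5 4 = true
cov _ _ = false

private
  2*suc : ∀ j → 2 * suc j ≡ 2 + 2 * j
  2*suc j rewrite +-suc j (j + 0) = refl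

  shift : ∀ {a b} → 5 + a ⋖ 6 + b → 7 + a ⋖ 8 + b
  shift (cL j) = subst (λ m → 5 + m ⋖ 6 + m) (2*suc j) (cL (suc j))
  shift (cR j) = subst (λ m → 7 + m ⋖ 6 + m) (2*suc j) (cR (suc j))

  soundHi : ∀ x y → T (covHi x y) → 5 + x ⋖ 6 + y
  soundHi (suc (suc x)) (suc (suc y)) t = shift (soundHi x y t)
  soundHi 0 0 _ = cL 0
  soundHi 2 0 _ = cR 0
  soundHi 0 (suc _) ()
  soundHi 1 _ ()
  soundHi (suc (suc (suc _))) 0 ()
  soundHi (suc (suc _)) 1 ()

  sound : ∀ a b → T (cov a b) → a ⋖ b
  sound (suc (suc (suc (suc (suc a))))) (suc (suc (suc (suc (suc (suc b)))))) t = soundHi a b t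
  sound 2 1 _ = c21
  sound 3 2 _ = c32
  sound 2 4 _ = c24
  sound 5 4 _ = c54
  sound 0 _ ()
  sound 1 _ ()
  sound 2 0 ()
  sound 2 2 ()
  sound 2 3 ()
  sound 2 (suc (suc (suc (suc (suc _))))) ()
  sound 3 0 ()
  sound 3 1 ()
  sound 3 (suc (suc (suc _))) ()
  sound 4 _ ()
  sound (suc (suc (suc (suc (suc _))))) 0 ()
  sound (suc (suc (suc (suc (suc _))))) 1 ()
  sound (suc (suc (suc (suc (suc _))))) 2 ()
  sound (suc (suc (suc (suc (suc _))))) 3 ()
  sound (suc (suc (suc (suc (suc _))))) 5 ()
  sound (suc (suc (suc (suc (suc (suc _)))))) 4 ()

  completeL : ∀ j → T (covHi (2 * j) (2 * j))
  completeL zero = tt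
  completeL (suc j) rewrite 2*suc j = completeL j

  completeR : ∀ j → T (covHi (2 + 2 * j) (2 * j))
  completeR zero = tt
  completeR (suc j) rewrite 2*suc j = completeR j

  complete : ∀ {a b} → a ⋖ b → T (cov a b)
  complete c21 = tt
  complete c32 = tt
  complete c24 = tt
  complete c54 = tt
  complete (cL j) = completeL j
  complete (cR j) = completeR j

  T? : ∀ x → Dec (T x)
  T? true = yes tt
  T? false = no λ ()

_⋖?_ : ∀ a b → Dec (a ⋖ b)
a ⋖? b = map′ (sound a b) complete (T? (cov a b))

CoverClosed : {n : ℕ} → Subset n → Set
CoverClosed {n} Y = ∀ (a b : Fin n) → Cover n a b → a ∈ Y → b ∈ Y

coverClosed? : {n : ℕ} → (Y : Subset n) → Dec (CoverClosed Y)
coverClosed? {n} Y = all? (λ a → all? (λ b →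
  (suc (toℕ a) ⋖? suc (toℕ b)) →-dec ((a ∈? Y) →-dec (b ∈? Y))))

private
  star-closed : ∀ {n} {Y : Subset n} → CoverClosed Y → IsFilter Y
  star-closed cc ε y = y
  star-closed cc (c ◅ s) y = star-closed cc s (cc _ _ c y)

isFilter? : {n : ℕ} → (Y : Subset n) → Dec (IsFilter Y)
isFilter? Y = map′ star-closed (λ f a b c → f (c ◅ ε)) (coverClosed? Y)

subsets : (n : ℕ) → List (Subset n)
subsets zero = [] ∷ []
subsets (suc n) = map (inside ∷_) (subsets n) ++ map (outside ∷_) (subsets n)

-- r n k = number of elements of rank k in F(φ_n)
--       = number of filters Y of φ_n with |Y| = n - k  (i.e. |Y| + k = n).

r : ℕ → ℕ → ℕ
r n k = length (filter (λ Y → isFilter? Y ×-dec (∣ Y ∣ + k ≟ n)) (subsets n))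

Poly : Set
Poly = ℕ → ℕ

R : ℕ → Poly
R n k = r n k

_⊕_ : Poly → Poly → Poly
(p ⊕ q) k = p k + q k

x^_·_ : ℕ → Poly → Poly
(x^ zero · p) k = p k
(x^ suc m · p) zero = 0
(x^ suc m · p) (suc k) = (x^ m · p) k

infixl 6 _⊕_
infixr 7 x^_·_

_≈_ : Poly → Poly → Set
p ≈ q = ∀ k → p k ≡ q k
infix 4 _≈_

-- Split the filters of φ_n by the membership of x_n and then of x_{n-1}.
-- For odd n, x_n is minimal and lies below only x_{n-1} inside φ_n: the filters
-- avoiding x_n are the filters of φ_{n-1}, one rank higher, and those containing
-- x_n also contain x_{n-1}, which is maximal in φ_{n-1}, so they are the filters
-- of φ_{n-2} together with these two elements.  For even n, x_n is maximal and
-- covers only x_{n-1} inside φ_n: the filters containing x_n are the filters of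
-- φ_{n-1}, and those avoiding x_n avoid x_{n-1}, which is minimal in φ_{n-1}, so
-- they are the filters of φ_{n-2}, two ranks higher.

module Submission where

open import Defs
open import Data.Nat using (ℕ; _≤_; _∸_)
open import Data.Nat.Divisibility using (_∣_)
open import Data.Product using (_×_)
open import Relation.Nullary using (¬_)

open import Level using (0ℓ)
open import Function using (_∘_)
open import Data.Nat using (zero; suc; pred; _+_; _*_; _<_; _≟_; z≤n; s≤s)
open import Data.Nat.Properties
open import Data.Nat.Divisibility using (divides; quotient; m∣n⇒n≡m*quotient; ∣m∣n⇒∣m+n; m∣m*n)
open import Algebra.Properties.CommutativeSemigroup +-commutativeSemigroup using (interchange)
open import Data.Bool using (true; false)
open import Data.Vec using ([]; _∷_; _∷ʳ_; here; there)
open import Data.Fin using (Fin; toℕ; fromℕ<) renaming (zero to fzero; suc to fsuc)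
open import Data.Fin.Properties using (toℕ<n; toℕ-fromℕ<)
open import Data.Fin.Subset using (Subset; Side; inside; outside; ∣_∣; _∈_)
open import Data.Fin.Subset.Properties using (∣p∣≤n)
open import Data.List using (List; []; _∷_; map; _++_; filter; length)
open import Data.List.Properties using (filter-++; filter-≐; filter-none; length-++)
open import Data.List.Relation.Unary.All using (universal)
open import Data.Product using (_,_; proj₁; proj₂; ∃-syntax)
open import Data.Sum using (_⊎_; inj₁; inj₂)
open import Data.Empty using (⊥; ⊥-elim)
open import Relation.Nullary using (does; contradiction)
open import Relation.Nullary.Decidable using (_×-dec_)
open import Relation.Unary using (Pred; Decidable; _≐_)
open import Relation.Binary.PropositionalEquality
open import Relation.Binary.Construct.Closure.ReflexiveTransitive using (ε; _◅_)

private
  variable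
    A B : Set
    m n : ℕ

count : {P : Pred A 0ℓ} → Decidable P → List A → ℕ
count P? xs = length (filter P? xs)

module _ {P : Pred A 0ℓ} (P? : Decidable P) where

  count-++ : ∀ xs ys → count P? (xs ++ ys) ≡ count P? xs + count P? ys
  count-++ xs ys = trans (cong length (filter-++ P? xs ys)) (length-++ (filter P? xs))

  count-map : ∀ (f : B → A) xs → count P? (map f xs) ≡ count (P? ∘ f) xs
  count-map f [] = refl
  count-map f (x ∷ xs) with does (P? (f x))
  ... | true  = cong suc (count-map f xs)
  ... | false = count-map f xs

  count-++-map : ∀ (f g : B → A) xs →
    count P? (map f xs ++ map g xs) ≡ count (P? ∘ f) xs + count (P? ∘ g) xs
  count-++-map f g xs = trans (count-++ (map f xs) (map g xs)) (cong₂ _+_ (count-map f xs) (count-map g xs))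

  count-none : (∀ x → ¬ P x) → ∀ xs → count P? xs ≡ 0
  count-none ¬P xs = cong length (filter-none P? (universal ¬P xs))

count-≐ : {P Q : Pred A 0ℓ} (P? : Decidable P) (Q? : Decidable Q) → P ≐ Q →
          ∀ xs → count P? xs ≡ count Q? xs
count-≐ P? Q? P≐Q xs = cong length (filter-≐ P? Q? P≐Q xs)

count-subsets-∷ʳ : ∀ n {P : Pred (Subset (suc n)) 0ℓ} (P? : Decidable P) →
  count P? (subsets (suc n)) ≡
  count (P? ∘ (_∷ʳ inside)) (subsets n) + count (P? ∘ (_∷ʳ outside)) (subsets n)
count-subsets-∷ʳ zero    P? = count-++-map P? (_∷ʳ inside) (_∷ʳ outside) (subsets zero)
count-subsets-∷ʳ (suc n) P? = begin
  count P? (subsets (2 + n))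
    ≡⟨ count-++-map P? (inside ∷_) (outside ∷_) (subsets (suc n)) ⟩
  count (P? ∘ (inside ∷_)) (subsets (suc n)) + count (P? ∘ (outside ∷_)) (subsets (suc n))
    ≡⟨ cong₂ _+_ (count-subsets-∷ʳ n _) (count-subsets-∷ʳ n _) ⟩
  (count₂ inside inside + count₂ inside outside) + (count₂ outside inside + count₂ outside outside)
    ≡⟨ interchange (count₂ inside inside) (count₂ inside outside) _ _ ⟩
  (count₂ inside inside + count₂ outside inside) + (count₂ inside outside + count₂ outside outside)
    ≡⟨ sym (cong₂ _+_ (count-++-map _ (inside ∷_) (outside ∷_) (subsets n))
                      (count-++-map _ (inside ∷_) (outside ∷_) (subsets n))) ⟩
  count (P? ∘ (_∷ʳ inside)) (subsets (suc n)) + count (P? ∘ (_∷ʳ outside)) (subsets (suc n)) ∎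
  where
  open ≡-Reasoning
  count₂ : Side → Side → ℕ
  count₂ c c′ = count (λ Y → P? (c ∷ (Y ∷ʳ c′))) (subsets n)

∣∷ʳ-inside∣ : (Y : Subset n) → ∣ Y ∷ʳ inside ∣ ≡ suc ∣ Y ∣
∣∷ʳ-inside∣ []            = refl
∣∷ʳ-inside∣ (inside ∷ Y)  = cong suc (∣∷ʳ-inside∣ Y)
∣∷ʳ-inside∣ (outside ∷ Y) = ∣∷ʳ-inside∣ Y

∣∷ʳ-outside∣ : (Y : Subset n) → ∣ Y ∷ʳ outside ∣ ≡ ∣ Y ∣
∣∷ʳ-outside∣ []            = refl
∣∷ʳ-outside∣ (inside ∷ Y)  = cong suc (∣∷ʳ-outside∣ Y)
∣∷ʳ-outside∣ (outside ∷ Y) = ∣∷ʳ-outside∣ Y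

-- at Y a is the membership of x_{a+1}, the fence being indexed from 1; indices
-- beyond the range count as outside.
at : Subset n → ℕ → Side
at []      _       = outside
at (x ∷ Y) zero    = x
at (x ∷ Y) (suc a) = at Y a

infix 4 _∈ᴺ_
_∈ᴺ_ : ℕ → Subset n → Set
a ∈ᴺ Y = at Y a ≡ inside

∈⇒∈ᴺ : {Y : Subset n} {i : Fin n} → i ∈ Y → toℕ i ∈ᴺ Y
∈⇒∈ᴺ here      = refl
∈⇒∈ᴺ (there p) = ∈⇒∈ᴺ p

∈ᴺ⇒∈ : (Y : Subset n) (i : Fin n) → toℕ i ∈ᴺ Y → i ∈ Y
∈ᴺ⇒∈ (inside ∷ Y) fzero    _ = here
∈ᴺ⇒∈ (x ∷ Y)      (fsuc i) p = there (∈ᴺ⇒∈ Y i p)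

∈ᴺ⇒< : (Y : Subset n) {a : ℕ} → a ∈ᴺ Y → a < n
∈ᴺ⇒< (x ∷ Y) {zero}  _ = s≤s z≤n
∈ᴺ⇒< (x ∷ Y) {suc a} p = s≤s (∈ᴺ⇒< Y p)

at-∷ʳ-< : (Y : Subset n) {c : Side} {a : ℕ} → a < n → at (Y ∷ʳ c) a ≡ at Y a
at-∷ʳ-< (x ∷ Y) {a = zero}  _         = refl
at-∷ʳ-< (x ∷ Y) {a = suc a} (s≤s a<n) = at-∷ʳ-< Y a<n

at-∷ʳ-last : (Y : Subset n) {c : Side} → at (Y ∷ʳ c) n ≡ c
at-∷ʳ-last []      = refl
at-∷ʳ-last (x ∷ Y) = at-∷ʳ-last Y

UpClosed : Subset n → Set
UpClosed {n} Y = ∀ {a b} → suc a ⋖ suc b → b < n → a ∈ᴺ Y → b ∈ᴺ Y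

isFilter⇒upClosed : {Y : Subset n} → IsFilter Y → UpClosed Y
isFilter⇒upClosed {n} {Y} filter {a} {b} a⋖b b<n a∈Y =
  subst (_∈ᴺ Y) (toℕ-fromℕ< b<n) (∈⇒∈ᴺ (filter (cover ◅ ε) (∈ᴺ⇒∈ Y i i∈Y)))
  where
  a<n = ∈ᴺ⇒< Y a∈Y
  i = fromℕ< a<n
  j = fromℕ< b<n
  cover : Cover n i j
  cover = subst₂ (λ x y → suc x ⋖ suc y) (sym (toℕ-fromℕ< a<n)) (sym (toℕ-fromℕ< b<n)) a⋖b
  i∈Y : toℕ i ∈ᴺ Y
  i∈Y = subst (_∈ᴺ Y) (sym (toℕ-fromℕ< a<n)) a∈Y

upClosed⇒isFilter : {Y : Subset n} → UpClosed Y → IsFilter Y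
upClosed⇒isFilter         up ε         i∈Y = i∈Y
upClosed⇒isFilter {Y = Y} up (c ◅ i≤j) i∈Y =
  upClosed⇒isFilter up i≤j (∈ᴺ⇒∈ Y _ (up c (toℕ<n _) (∈⇒∈ᴺ i∈Y)))

⋖⇒≢ : ∀ {a b} → a ⋖ b → a ≢ b
⋖⇒≢ c21    ()
⋖⇒≢ c32    ()
⋖⇒≢ c24    ()
⋖⇒≢ c54    ()
⋖⇒≢ (cL j) e = <-irrefl e (n<1+n _)
⋖⇒≢ (cR j) e = <-irrefl (sym e) (n<1+n _)

odd-minimal : ∀ t {a} → ¬ a ⋖ 5 + 2 * t
odd-minimal t a⋖ = lemma a⋖ refl
  where
  lemma : ∀ {a b} → a ⋖ b → b ≡ 5 + 2 * t → ⊥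
  lemma (cL j) e = even≢odd t j (sym (cong (_∸ 5) e))
  lemma (cR j) e = even≢odd t j (sym (cong (_∸ 5) e))

even-maximal : ∀ t {b} → ¬ 4 + 2 * t ⋖ b
even-maximal t ⋖b = lemma ⋖b refl
  where
  lemma : ∀ {a b} → a ⋖ b → a ≡ 4 + 2 * t → ⊥
  lemma c54    e = even≢odd t 0 (sym (cong (_∸ 4) e))
  lemma (cL j) e = even≢odd t j (sym (cong (_∸ 4) e))
  lemma (cR j) e = even≢odd t (suc j) (sym (trans (cong suc (*-suc 2 j)) (cong (_∸ 4) e)))

odd-covers : ∀ t {b} → 5 + 2 * t ⋖ b → b ≡ 4 + 2 * t ⊎ b ≡ 6 + 2 * t
odd-covers t ⋖b = lemma ⋖b refl
  where
  lemma : ∀ {a b} → a ⋖ b → a ≡ 5 + 2 * t → b ≡ 4 + 2 * t ⊎ b ≡ 6 + 2 * t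
  lemma c54    e = inj₁ (cong pred e)
  lemma (cL j) e = inj₂ (cong suc e)
  lemma (cR j) e = inj₁ (cong pred e)

even-covered : ∀ t {a} → a ⋖ 6 + 2 * t → a ≡ 5 + 2 * t ⊎ a ≡ 7 + 2 * t
even-covered t a⋖ = lemma a⋖ refl
  where
  lemma : ∀ {a b} → a ⋖ b → b ≡ 6 + 2 * t → a ≡ 5 + 2 * t ⊎ a ≡ 7 + 2 * t
  lemma (cL j) e = inj₁ (cong pred e)
  lemma (cR j) e = inj₂ (cong suc e)

odd-covers-predecessor : ∀ t → 5 + 2 * t ⋖ 4 + 2 * t
odd-covers-predecessor zero    = c54
odd-covers-predecessor (suc t) = subst (λ x → 5 + x ⋖ 4 + x) (sym (*-suc 2 t)) (cR t)

module _ (Y : Subset n) {c : Side} where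

  ∈ᴺ-∷ʳ⁺ : ∀ {a} → a < n → a ∈ᴺ Y → a ∈ᴺ Y ∷ʳ c
  ∈ᴺ-∷ʳ⁺ a<n = trans (at-∷ʳ-< Y a<n)

  ∈ᴺ-∷ʳ⁻ : ∀ {a} → a < n → a ∈ᴺ Y ∷ʳ c → a ∈ᴺ Y
  ∈ᴺ-∷ʳ⁻ a<n = trans (sym (at-∷ʳ-< Y a<n))

  isFilter-∷ʳ⁻ : IsFilter (Y ∷ʳ c) → IsFilter Y
  isFilter-∷ʳ⁻ filter = upClosed⇒isFilter λ a⋖b b<n a∈Y →
    ∈ᴺ-∷ʳ⁻ b<n (isFilter⇒upClosed filter a⋖b (m<n⇒m<1+n b<n) (∈ᴺ-∷ʳ⁺ (∈ᴺ⇒< Y a∈Y) a∈Y))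

  isFilter-∷ʳ-below : IsFilter (Y ∷ʳ c) → ∀ {a} → suc a ⋖ suc n → a ∈ᴺ Y → c ≡ inside
  isFilter-∷ʳ-below filter a⋖ a∈Y =
    trans (sym (at-∷ʳ-last Y)) (isFilter⇒upClosed filter a⋖ (n<1+n n) (∈ᴺ-∷ʳ⁺ (∈ᴺ⇒< Y a∈Y) a∈Y))

  isFilter-∷ʳ⁺ : IsFilter Y →
    (∀ {a} → suc a ⋖ suc n → a ∈ᴺ Y → c ≡ inside) →
    (∀ {b} → suc n ⋖ suc b → b < n → c ≡ inside → b ∈ᴺ Y) →
    IsFilter (Y ∷ʳ c)
  isFilter-∷ʳ⁺ filter below above = upClosed⇒isFilter closed
    where
    closed : UpClosed (Y ∷ʳ c)
    closed {a} {b} a⋖b b<1+n a∈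
      with m<1+n⇒m<n∨m≡n (∈ᴺ⇒< (Y ∷ʳ c) a∈) | m<1+n⇒m<n∨m≡n b<1+n
    ... | inj₁ a<n  | inj₁ b<n  = ∈ᴺ-∷ʳ⁺ b<n (isFilter⇒upClosed filter a⋖b b<n (∈ᴺ-∷ʳ⁻ a<n a∈))
    ... | inj₁ a<n  | inj₂ refl = trans (at-∷ʳ-last Y) (below a⋖b (∈ᴺ-∷ʳ⁻ a<n a∈))
    ... | inj₂ refl | inj₁ b<n  = ∈ᴺ-∷ʳ⁺ b<n (above a⋖b b<n (trans (sym (at-∷ʳ-last Y)) a∈))
    ... | inj₂ refl | inj₂ refl = contradiction refl (⋖⇒≢ a⋖b)

isFilter-∷ʳ-above : (Y : Subset n) → IsFilter (Y ∷ʳ inside) →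
                    ∀ {b} → suc n ⋖ suc b → b < n → b ∈ᴺ Y
isFilter-∷ʳ-above Y filter ⋖b b<n =
  ∈ᴺ-∷ʳ⁻ Y b<n (isFilter⇒upClosed filter ⋖b (m<n⇒m<1+n b<n) (at-∷ʳ-last Y))

isFilter-∷ʳ-maximal : (∀ {b} → ¬ suc n ⋖ b) →
                      (λ (Y : Subset n) → IsFilter (Y ∷ʳ inside)) ≐ IsFilter
isFilter-∷ʳ-maximal maximal =
  (λ {Y} → isFilter-∷ʳ⁻ Y) ,
  λ {Y} filter → isFilter-∷ʳ⁺ Y filter (λ _ _ → refl) (λ ⋖b → ⊥-elim (maximal ⋖b))

isFilter-∷ʳ-minimal : (∀ {a} → ¬ a ⋖ suc n) →
                      (λ (Y : Subset n) → IsFilter (Y ∷ʳ outside)) ≐ IsFilter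
isFilter-∷ʳ-minimal minimal =
  (λ {Y} → isFilter-∷ʳ⁻ Y) ,
  λ {Y} filter → isFilter-∷ʳ⁺ Y filter (λ a⋖ → ⊥-elim (minimal a⋖)) (λ _ _ ())

isFilter-∷ʳ-inside-inside : ∀ t →
  (λ (Z : Subset (3 + 2 * t)) → IsFilter ((Z ∷ʳ inside) ∷ʳ inside)) ≐ IsFilter
isFilter-∷ʳ-inside-inside t =
  (λ {Z} → isFilter-∷ʳ⁻ Z ∘ isFilter-∷ʳ⁻ (Z ∷ʳ inside)) ,
  λ {Z} filter → isFilter-∷ʳ⁺ (Z ∷ʳ inside)
    (proj₂ (isFilter-∷ʳ-maximal (even-maximal t)) filter) (λ _ _ → refl) (above Z)
  where
  above : (Z : Subset (3 + 2 * t)) →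
          ∀ {b} → 5 + 2 * t ⋖ suc b → b < 4 + 2 * t → inside ≡ inside → b ∈ᴺ Z ∷ʳ inside
  above Z ⋖b b< _ with odd-covers t ⋖b
  ... | inj₁ refl = at-∷ʳ-last Z
  ... | inj₂ refl = contradiction (n<1+n _) (<-asym b<)

isFilter-∷ʳ-outside-outside : ∀ t →
  (λ (Z : Subset (4 + 2 * t)) → IsFilter ((Z ∷ʳ outside) ∷ʳ outside)) ≐ IsFilter
isFilter-∷ʳ-outside-outside t =
  (λ {Z} → isFilter-∷ʳ⁻ Z ∘ isFilter-∷ʳ⁻ (Z ∷ʳ outside)) ,
  λ {Z} filter → isFilter-∷ʳ⁺ (Z ∷ʳ outside)
    (proj₂ (isFilter-∷ʳ-minimal (odd-minimal t)) filter) (below Z) (λ _ _ ())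
  where
  below : (Z : Subset (4 + 2 * t)) →
          ∀ {a} → suc a ⋖ 6 + 2 * t → a ∈ᴺ Z ∷ʳ outside → outside ≡ inside
  below Z a⋖ a∈ with even-covered t a⋖
  ... | inj₁ refl = trans (sym (at-∷ʳ-last Z)) a∈
  ... | inj₂ refl = contradiction (n<1+n _) (<-asym (∈ᴺ⇒< (Z ∷ʳ outside) a∈))

¬isFilter-∷ʳ-outside-inside : ∀ t (Z : Subset (3 + 2 * t)) → ¬ IsFilter ((Z ∷ʳ outside) ∷ʳ inside)
¬isFilter-∷ʳ-outside-inside t Z filter with
  trans (sym (at-∷ʳ-last Z))
        (isFilter-∷ʳ-above (Z ∷ʳ outside) filter (odd-covers-predecessor t) (n<1+n _))
... | ()

¬isFilter-∷ʳ-inside-outside : ∀ t (Z : Subset (4 + 2 * t)) → ¬ IsFilter ((Z ∷ʳ inside) ∷ʳ outside)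
¬isFilter-∷ʳ-inside-outside t Z filter
  with isFilter-∷ʳ-below (Z ∷ʳ inside) filter (cL t) (at-∷ʳ-last Z)
... | ()

Rank : ℕ → ℕ → Pred (Subset n) 0ℓ
Rank N k Y = IsFilter Y × ∣ Y ∣ + k ≡ N

rank? : ∀ N k → Decidable (Rank {n} N k)
rank? N k Y = isFilter? Y ×-dec (∣ Y ∣ + k ≟ N)

Rank-suc : ∀ {N k} → Rank {n} (suc N) (suc k) ≐ Rank N k
Rank-suc {k = k} =
  (λ (filter , size) → filter , suc-injective (trans (sym (+-suc _ k)) size)) ,
  (λ (filter , size) → filter , trans (+-suc _ k) (cong suc size))

-- Φ adds d elements to every filter and leaves e further elements of φ_{e+d+m}
-- out, so it shifts ranks by e.
count-rank-∘ : (Φ : Subset m → Subset n) (d : ℕ) →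
  (IsFilter ∘ Φ) ≐ IsFilter → (∀ Y → ∣ Φ Y ∣ ≡ d + ∣ Y ∣) →
  ∀ e k → count (rank? (e + (d + m)) k ∘ Φ) (subsets m) ≡ (x^ e · R m) k
count-rank-∘ {m} Φ d filterΦ sizeΦ zero k = count-≐ _ _
  ((λ {Y} (filter , size) → proj₁ filterΦ filter , +-cancelˡ-≡ d _ _ (trans (sym (sizeΦ+ Y)) size)) ,
   (λ {Y} (filter , size) → proj₂ filterΦ filter , trans (sizeΦ+ Y) (cong (d +_) size)))
  (subsets m)
  where
  sizeΦ+ : ∀ Y → ∣ Φ Y ∣ + k ≡ d + (∣ Y ∣ + k)
  sizeΦ+ Y = trans (cong (_+ k) (sizeΦ Y)) (+-assoc d ∣ Y ∣ k)
count-rank-∘ {m} Φ d filterΦ sizeΦ (suc e) zero =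
  count-none _ (λ Y (_ , size) → too-large Y size) (subsets m)
  where
  too-large : ∀ Y → ¬ ∣ Φ Y ∣ + 0 ≡ suc (e + (d + m))
  too-large Y size = <-irrefl refl (begin
    suc (e + (d + m)) ≡⟨ sym size ⟩
    ∣ Φ Y ∣ + 0       ≡⟨ +-identityʳ _ ⟩
    ∣ Φ Y ∣           ≡⟨ sizeΦ Y ⟩
    d + ∣ Y ∣         ≤⟨ +-monoʳ-≤ d (∣p∣≤n Y) ⟩
    d + m             ≤⟨ m≤n+m (d + m) e ⟩
    e + (d + m)       ∎)
    where open ≤-Reasoning
count-rank-∘ {m} Φ d filterΦ sizeΦ (suc e) (suc k) =
  trans (count-≐ _ _ (proj₁ Rank-suc , proj₂ Rank-suc) (subsets m))
        (count-rank-∘ Φ d filterΦ sizeΦ e k)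

R-odd : ∀ t → R (5 + 2 * t) ≈ x^ 1 · R (4 + 2 * t) ⊕ R (3 + 2 * t)
R-odd t k = begin
  R (5 + 2 * t) k                   ≡⟨ count-subsets-∷ʳ (4 + 2 * t) (rank? (5 + 2 * t) k) ⟩
  # (_∷ʳ inside) + # (_∷ʳ outside)  ≡⟨ cong (_+ # (_∷ʳ outside)) (count-subsets-∷ʳ (3 + 2 * t) _) ⟩
  (# (λ Z → (Z ∷ʳ inside) ∷ʳ inside) + # (λ Z → (Z ∷ʳ outside) ∷ʳ inside)) + # (_∷ʳ outside)
    ≡⟨ cong₂ _+_ (cong₂ _+_ count-inside-inside count-outside-inside) count-outside ⟩
  (R (3 + 2 * t) k + 0) + (x^ 1 · R (4 + 2 * t)) k
    ≡⟨ cong (_+ (x^ 1 · R (4 + 2 * t)) k) (+-identityʳ (R (3 + 2 * t) k)) ⟩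
  R (3 + 2 * t) k + (x^ 1 · R (4 + 2 * t)) k
    ≡⟨ +-comm (R (3 + 2 * t) k) _ ⟩
  (x^ 1 · R (4 + 2 * t)) k + R (3 + 2 * t) k ∎
  where
  open ≡-Reasoning
  #_ : ∀ {m} → (Subset m → Subset (5 + 2 * t)) → ℕ
  #_ {m} Φ = count (rank? (5 + 2 * t) k ∘ Φ) (subsets m)
  count-inside-inside =
    count-rank-∘ (λ Z → (Z ∷ʳ inside) ∷ʳ inside) 2 (isFilter-∷ʳ-inside-inside t)
    (λ Z → trans (∣∷ʳ-inside∣ (Z ∷ʳ inside)) (cong suc (∣∷ʳ-inside∣ Z))) 0 k
  count-outside-inside = count-none _ (λ Z → ¬isFilter-∷ʳ-outside-inside t Z ∘ proj₁) (subsets _)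
  count-outside = count-rank-∘ (_∷ʳ outside) 0 (isFilter-∷ʳ-minimal (odd-minimal t)) ∣∷ʳ-outside∣ 1 k

R-even : ∀ t → R (6 + 2 * t) ≈ R (5 + 2 * t) ⊕ x^ 2 · R (4 + 2 * t)
R-even t k = begin
  R (6 + 2 * t) k                   ≡⟨ count-subsets-∷ʳ (5 + 2 * t) (rank? (6 + 2 * t) k) ⟩
  # (_∷ʳ inside) + # (_∷ʳ outside)  ≡⟨ cong (# (_∷ʳ inside) +_) (count-subsets-∷ʳ (4 + 2 * t) _) ⟩
  # (_∷ʳ inside) + (# (λ Z → (Z ∷ʳ inside) ∷ʳ outside) + # (λ Z → (Z ∷ʳ outside) ∷ʳ outside))
    ≡⟨ cong₂ _+_ count-inside (cong₂ _+_ count-inside-outside count-outside-outside) ⟩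
  R (5 + 2 * t) k + (0 + (x^ 2 · R (4 + 2 * t)) k)   ∎
  where
  open ≡-Reasoning
  #_ : ∀ {m} → (Subset m → Subset (6 + 2 * t)) → ℕ
  #_ {m} Φ = count (rank? (6 + 2 * t) k ∘ Φ) (subsets m)
  maximal : ∀ {b} → ¬ 6 + 2 * t ⋖ b
  maximal {b} = even-maximal (suc t) ∘ subst (_⋖ b) (cong (4 +_) (sym (*-suc 2 t)))
  count-inside = count-rank-∘ (_∷ʳ inside) 1 (isFilter-∷ʳ-maximal maximal) ∣∷ʳ-inside∣ 0 k
  count-inside-outside = count-none _ (λ Z → ¬isFilter-∷ʳ-inside-outside t Z ∘ proj₁) (subsets _)
  count-outside-outside =
    count-rank-∘ (λ Z → (Z ∷ʳ outside) ∷ʳ outside) 0 (isFilter-∷ʳ-outside-outside t)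
    (λ Z → trans (∣∷ʳ-outside∣ (Z ∷ʳ outside)) (∣∷ʳ-outside∣ Z)) 2 k

parity : ∀ d → (∃[ t ] d ≡ 2 * t) ⊎ (∃[ t ] d ≡ suc (2 * t))
parity zero = inj₁ (0 , refl)
parity (suc d) with parity d
... | inj₁ (t , d≡2t)   = inj₂ (t , cong suc d≡2t)
... | inj₂ (t , d≡1+2t) = inj₁ (suc t , trans (cong suc d≡1+2t) (sym (*-suc 2 t)))

odd-or-even-≥5 : 5 ≤ n → (∃[ t ] n ≡ 5 + 2 * t) ⊎ (∃[ t ] n ≡ 6 + 2 * t)
odd-or-even-≥5 {n} 5≤n with parity (n ∸ 5)
... | inj₁ (t , e) = inj₁ (t , trans (sym (m+[n∸m]≡n 5≤n)) (cong (5 +_) e))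
... | inj₂ (t , e) = inj₂ (t , trans (sym (m+[n∸m]≡n 5≤n)) (cong (5 +_) e))

2∤5+2t : ∀ t → ¬ 2 ∣ 5 + 2 * t
2∤5+2t t 2∣ = even≢odd (quotient 2∣) (2 + t)
  (sym (trans (cong suc (*-distribˡ-+ 2 2 t)) (m∣n⇒n≡m*quotient 2∣)))

2∣6+2t : ∀ t → 2 ∣ 6 + 2 * t
2∣6+2t t = ∣m∣n⇒∣m+n (divides 3 refl) (m∣m*n t)

proposition1 : ∀ (n : ℕ) → 5 ≤ n →
    (¬ (2 ∣ n) → R n ≈ x^ 1 · R (n ∸ 1) ⊕ R (n ∸ 2)) ×
    (2 ∣ n → R n ≈ R (n ∸ 1) ⊕ x^ 2 · R (n ∸ 2))
proposition1 n 5≤n with odd-or-even-≥5 5≤n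
... | inj₁ (t , refl) = (λ _ → R-odd t) , (λ 2∣n → contradiction 2∣n (2∤5+2t t))
... | inj₂ (t , refl) = (λ 2∤n → contradiction (2∣6+2t t) 2∤n) , (λ _ → R-even t)
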